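{- Let $G$ be a cubic planar graph and let $H$ be the corresponding auxiliary graph (defined in the context). If $H$ has a good coloured orientation, then $G$ has a two-coloured perfect matching.
   Context: A two-coloured perfect matching of $G$ is a colouring of its vertices with black and white in which every vertex has exactly one neighbour of the same colour. The auxiliary graph $H$ is obtained from $G$ by replacing every edge $uv$ of $G$ by the following gadget (an auxiliary edge): new vertices $x,y,z,w,\mathrm{in},\mathrm{out}$ with edges $ux,xy,xz,yw,zw,wv,y\,\mathrm{in},z\,\mathrm{out}$; the vertex $\mathrm{in}$ is the invertex and $\mathrm{out}$ the outvertex. A coloured orientation of $H$ is a colouring of its vertices with black and white together with an orientation of some of its edges such that: every vertex is adjacent to at most one vertex of the opposite colour; an edge is oriented if and only if it is monochromatic (both ends of the same colour); every vertex except the outvertices has outdegree at most two and indegree at most one (unoriented edges not counted); every outvertex has indegree zero. A coloured orientation is good if every vertex of degree three is adjacent to precisely one vertex of the opposite colour and has indegree one and outdegree one. -}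

module Defs where

open import Data.Nat using (ℕ; zero; suc; _+_; _*_)
open import Data.Fin using (Fin)
open import Data.Bool using (Bool; true; false; not)
open import Data.Product using (Σ; ∃; ∃-syntax; _×_; _,_; proj₁; proj₂)
open import Data.Sum using (_⊎_)
open import Data.Empty using (⊥)
open import Relation.Nullary using (¬_)
open import Relation.Binary.PropositionalEquality using (_≡_; _≢_)

Degree3 : {V : Set} → (V → V → Set) → V → Set
Degree3 {V} Adj v =
  Σ V λ a → Σ V λ b → Σ V λ c →
    a ≢ b × a ≢ c × b ≢ c ×
    Adj v a × Adj v b × Adj v c ×
    (∀ d → Adj v d → d ≡ a ⊎ d ≡ b ⊎ d ≡ c)

-- Edge e is
-- stored as an ordered pair (src e , tgt e); the order is an arbitrary
-- choice (it is used to fix how the gadget of H is attached).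

record SimpleGraph (n m : ℕ) : Set where
  field
    ends     : Fin m → Fin n × Fin n
    loopless : ∀ e → proj₁ (ends e) ≢ proj₂ (ends e)
    noMulti  : ∀ e e' →
      (ends e ≡ ends e' ⊎ (proj₁ (ends e) ≡ proj₂ (ends e') × proj₂ (ends e) ≡ proj₁ (ends e'))) →
      e ≡ e'

  src tgt : Fin m → Fin n
  src e = proj₁ (ends e)
  tgt e = proj₂ (ends e)

  Adj : Fin n → Fin n → Set
  Adj u v = ∃[ e ] ((src e ≡ u × tgt e ≡ v) ⊎ (src e ≡ v × tgt e ≡ u))

open SimpleGraph public

Cubic : ∀ {n m} → SimpleGraph n m → Set
Cubic G = ∀ v → Degree3 (Adj G) v

-- Planarity, via combinatorial maps (rotation systems): G is planar iff
-- it has a rotation system whose Euler characteristic is 2 per connected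
-- component:  n - m + f = 2c.  (G cubic, so there are no isolated vertices
-- and components are exactly the classes of darts under <σ, α>.)

iter : {A : Set} → (A → A) → ℕ → A → A
iter f zero    x = x
iter f (suc k) x = f (iter f k x)

Dart : ℕ → Set
Dart m = Fin m × Bool

NumClasses : {A : Set} → (A → A → Set) → ℕ → Set
NumClasses {A} R k =
  Σ (Fin k → A) λ rep →
    (∀ i j → R (rep i) (rep j) → i ≡ j) × (∀ x → ∃[ i ] R (rep i) x)

module _ {n m : ℕ} (G : SimpleGraph n m) where

  dartTail : Dart m → Fin n
  dartTail (e , false) = src G e
  dartTail (e , true)  = tgt G e

  α : Dart m → Dart m
  α (e , b) = (e , not b)

  record RotationSystem : Set where
    field
      σ        : Dart m → Dart m
      σ⁻¹      : Dart m → Dart m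
      σσ⁻¹     : ∀ d → σ (σ⁻¹ d) ≡ d
      σ⁻¹σ     : ∀ d → σ⁻¹ (σ d) ≡ d
      σ-tail   : ∀ d → dartTail (σ d) ≡ dartTail d
      σ-cyclic : ∀ d d' → dartTail d ≡ dartTail d' → ∃[ k ] iter σ k d ≡ d'

    φ : Dart m → Dart m
    φ d = σ (α d)

    SameFace : Dart m → Dart m → Set
    SameFace d d' = ∃[ k ] iter φ k d ≡ d'

  data Reach (σ : Dart m → Dart m) : Dart m → Dart m → Set where
    here  : ∀ {d} → Reach σ d d
    stepσ : ∀ {d d'} → Reach σ d d' → Reach σ d (σ d')
    stepα : ∀ {d d'} → Reach σ d d' → Reach σ d (α d')

  Planar : Set
  Planar = Σ RotationSystem λ ρ → Σ ℕ λ f → Σ ℕ λ c →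
    NumClasses (RotationSystem.SameFace ρ) f ×
    NumClasses (Reach (RotationSystem.σ ρ)) c ×
    n + f ≡ m + 2 * c

TwoColouredPM : ∀ {n m} → SimpleGraph n m → Set
TwoColouredPM {n} G =
  Σ (Fin n → Bool) λ col → ∀ v →
    Σ (Fin n) λ a → Adj G v a × col a ≡ col v ×
      (∀ b → Adj G v b → col b ≡ col v → b ≡ a)

data Gad : Set where
  gx gy gz gw gin gout : Gad

data HV (n m : ℕ) : Set where
  orig : Fin n → HV n m
  gad  : Fin m → Gad → HV n m

data HEdge {n m : ℕ} (G : SimpleGraph n m) : HV n m → HV n m → Set where
  e-ux   : ∀ e → HEdge G (orig (src G e)) (gad e gx)
  e-xy   : ∀ e → HEdge G (gad e gx) (gad e gy)
  e-xz   : ∀ e → HEdge G (gad e gx) (gad e gz)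
  e-yw   : ∀ e → HEdge G (gad e gy) (gad e gw)
  e-zw   : ∀ e → HEdge G (gad e gz) (gad e gw)
  e-wv   : ∀ e → HEdge G (gad e gw) (orig (tgt G e))
  e-yin  : ∀ e → HEdge G (gad e gy) (gad e gin)
  e-zout : ∀ e → HEdge G (gad e gz) (gad e gout)

HAdj : ∀ {n m} → SimpleGraph n m → HV n m → HV n m → Set
HAdj G a b = HEdge G a b ⊎ HEdge G b a

IsOutvertex : ∀ {n m} → HV n m → Set
IsOutvertex {n} {m} v = ∃[ e ] v ≡ gad e gout

record ColouredOrientation {V : Set} (Adj : V → V → Set) (IsOut : V → Set) : Set₁ where
  field
    col : V → Bool
    Arc : V → V → Set
    arc-edge   : ∀ {u v} → Arc u v → Adj u v
    arc-single : ∀ {u v} → Arc u v → Arc v u → ⊥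
    arc-mono   : ∀ {u v} → Arc u v → col u ≡ col v
    mono-arc   : ∀ {u v} → Adj u v → col u ≡ col v → Arc u v ⊎ Arc v u
    opp≤1      : ∀ {v a b} → Adj v a → Adj v b → col a ≢ col v → col b ≢ col v → a ≡ b
    outdeg≤2   : ∀ {v} → ¬ IsOut v → ∀ {a b c} → Arc v a → Arc v b → Arc v c →
                 a ≡ b ⊎ a ≡ c ⊎ b ≡ c
    indeg≤1    : ∀ {v} → ¬ IsOut v → ∀ {a b} → Arc a v → Arc b v → a ≡ b
    out-indeg0 : ∀ {v} → IsOut v → ∀ {a} → ¬ Arc a v

Good : {V : Set} {Adj : V → V → Set} {IsOut : V → Set} →
       ColouredOrientation Adj IsOut → Set
Good {V} {Adj} {IsOut} co = ∀ v → Degree3 Adj v →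
    (Σ V λ a → Adj v a × col a ≢ col v ×
       (∀ b → Adj v b → col b ≢ col v → b ≡ a)) ×
    (Σ V λ a → Arc a v × (∀ b → Arc b v → b ≡ a)) ×
    (Σ V λ a → Arc v a × (∀ b → Arc v b → b ≡ a))
  where open ColouredOrientation co

-- In the
-- gadget of an edge uv each of x, y, z, w has exactly one neighbour of the
-- other colour, and this forces x to be coloured opposite to v and w opposite
-- to u: if y and z both agree with x, then w agrees with them too, so u differs
-- from x and v from w; otherwise exactly one of y, z (say y) differs from x,
-- then w agrees with y and differs from z, so u agrees with x and v with w.
-- Hence at a vertex u of G, the gadget vertex next to u has the other colour
-- exactly when the G-neighbour across the edge has the same colour, so the
-- unique opposite H-neighbour of u yields the unique same-coloured
-- G-neighbour of u.
module Submission where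

open import Defs
open import Data.Nat using (ℕ)
open import Data.Fin using (Fin)
open import Data.Bool using (Bool; true; false)
open import Data.Bool.Properties using (_≟_; ¬-not)
open import Data.Product using (Σ; _×_; _,_; proj₁; proj₂)
open import Data.Sum using (_⊎_; inj₁; inj₂)
open import Data.Empty using (⊥-elim)
open import Function using (_∘_)
open import Relation.Nullary using (Dec)
open import Relation.Nullary.Decidable
  using (from-yes; map′; ¬?; decidable-stable; _×-dec_; _⊎-dec_; _→-dec_)
open import Relation.Binary.PropositionalEquality

Neighbours3 : {V : Set} → (V → V → Set) → V → V → V → V → Set
Neighbours3 Adj v a b c =
  a ≢ b × a ≢ c × b ≢ c ×
  Adj v a × Adj v b × Adj v c ×
  (∀ d → Adj v d → d ≡ a ⊎ d ≡ b ⊎ d ≡ c)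

UniqueOpposite : {V : Set} → (V → V → Set) → (V → Bool) → V → Set
UniqueOpposite {V} Adj col v =
  Σ V λ a → Adj v a × col a ≢ col v × (∀ b → Adj v b → col b ≢ col v → b ≡ a)

ExactlyOneOpposite : Bool → Bool → Bool → Bool → Set
ExactlyOneOpposite c p q r =
  (p ≢ c × q ≡ c × r ≡ c) ⊎ (p ≡ c × q ≢ c × r ≡ c) ⊎ (p ≡ c × q ≡ c × r ≢ c)

exactlyOneOpposite? : ∀ c p q r → Dec (ExactlyOneOpposite c p q r)
exactlyOneOpposite? c p q r =
  (¬? (p ≟ c) ×-dec q ≟ c ×-dec r ≟ c) ⊎-dec
  (p ≟ c ×-dec ¬? (q ≟ c) ×-dec r ≟ c) ⊎-dec
  (p ≟ c ×-dec q ≟ c ×-dec ¬? (r ≟ c))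

∀-Bool? : {P : Bool → Set} → (∀ b → Dec (P b)) → Dec (∀ b → P b)
∀-Bool? P? = map′ (λ (f , t) → λ { false → f ; true → t }) (λ h → h false , h true)
                  (P? false ×-dec P? true)

≢-≢⇒≡ : {a b c : Bool} → a ≢ c → b ≢ c → a ≡ b
≢-≢⇒≡ a≢c b≢c = trans (¬-not a≢c) (sym (¬-not b≢c))

module _ {V : Set} (Adj : V → V → Set) (col : V → Bool) where

  others-agree : ∀ {v} ((a , _ , _ , _) : UniqueOpposite Adj col v) →
    ∀ b → Adj v b → b ≢ a → col b ≡ col v
  others-agree {v} (_ , _ , _ , unique) b vb b≢a =
    decidable-stable (col b ≟ col v) (b≢a ∘ unique b vb)

  uniqueOpposite⇒exactlyOne : ∀ {v p q r} → Neighbours3 Adj v p q r →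
    UniqueOpposite Adj col v → ExactlyOneOpposite (col v) (col p) (col q) (col r)
  uniqueOpposite⇒exactlyOne (p≢q , p≢r , q≢r , vp , vq , vr , complete) U@(a , va , a≢v , _)
    with complete a va
  ... | inj₁ refl =
    inj₁ (a≢v , others-agree U _ vq (p≢q ∘ sym) , others-agree U _ vr (p≢r ∘ sym))
  ... | inj₂ (inj₁ refl) =
    inj₂ (inj₁ (others-agree U _ vp p≢q , a≢v , others-agree U _ vr (q≢r ∘ sym)))
  ... | inj₂ (inj₂ refl) =
    inj₂ (inj₂ (others-agree U _ vp p≢r , others-agree U _ vq q≢r , a≢v))

gadget-ends-opposite : ∀ u x y z w v i o →
  ExactlyOneOpposite x u y z → ExactlyOneOpposite y x w i →
  ExactlyOneOpposite z x w o → ExactlyOneOpposite w y z v →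
  x ≢ v × w ≢ u
gadget-ends-opposite = from-yes
  (∀-Bool? λ u → ∀-Bool? λ x → ∀-Bool? λ y → ∀-Bool? λ z →
   ∀-Bool? λ w → ∀-Bool? λ v → ∀-Bool? λ i → ∀-Bool? λ o →
   exactlyOneOpposite? x u y z →-dec exactlyOneOpposite? y x w i →-dec
   exactlyOneOpposite? z x w o →-dec exactlyOneOpposite? w y z v →-dec
   ¬? (x ≟ v) ×-dec ¬? (w ≟ u))

module _ {n m : ℕ} (G : SimpleGraph n m) where

  x-neighbours : ∀ e → Neighbours3 (HAdj G) (gad e gx) (orig (src G e)) (gad e gy) (gad e gz)
  x-neighbours e = (λ ()) , (λ ()) , (λ ()) , inj₂ (e-ux e) , inj₁ (e-xy e) , inj₁ (e-xz e) , λ where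
    _ (inj₂ (e-ux _)) → inj₁ refl
    _ (inj₁ (e-xy _)) → inj₂ (inj₁ refl)
    _ (inj₁ (e-xz _)) → inj₂ (inj₂ refl)

  y-neighbours : ∀ e → Neighbours3 (HAdj G) (gad e gy) (gad e gx) (gad e gw) (gad e gin)
  y-neighbours e = (λ ()) , (λ ()) , (λ ()) , inj₂ (e-xy e) , inj₁ (e-yw e) , inj₁ (e-yin e) , λ where
    _ (inj₂ (e-xy _))  → inj₁ refl
    _ (inj₁ (e-yw _))  → inj₂ (inj₁ refl)
    _ (inj₁ (e-yin _)) → inj₂ (inj₂ refl)

  z-neighbours : ∀ e → Neighbours3 (HAdj G) (gad e gz) (gad e gx) (gad e gw) (gad e gout)
  z-neighbours e = (λ ()) , (λ ()) , (λ ()) , inj₂ (e-xz e) , inj₁ (e-zw e) , inj₁ (e-zout e) , λ where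
    _ (inj₂ (e-xz _))   → inj₁ refl
    _ (inj₁ (e-zw _))   → inj₂ (inj₁ refl)
    _ (inj₁ (e-zout _)) → inj₂ (inj₂ refl)

  w-neighbours : ∀ e → Neighbours3 (HAdj G) (gad e gw) (gad e gy) (gad e gz) (orig (tgt G e))
  w-neighbours e = (λ ()) , (λ ()) , (λ ()) , inj₂ (e-yw e) , inj₂ (e-zw e) , inj₁ (e-wv e) , λ where
    _ (inj₂ (e-yw _)) → inj₁ refl
    _ (inj₂ (e-zw _)) → inj₂ (inj₁ refl)
    _ (inj₁ (e-wv _)) → inj₂ (inj₂ refl)

  gadgetEnd : ∀ {v d} → Adj G v d → HV n m
  gadgetEnd (e , inj₁ _) = gad e gx
  gadgetEnd (e , inj₂ _) = gad e gw

  gadgetEnd-adjacent : ∀ {v d} (vd : Adj G v d) → HAdj G (orig v) (gadgetEnd vd)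
  gadgetEnd-adjacent (e , inj₁ (refl , _)) = inj₁ (e-ux e)
  gadgetEnd-adjacent (e , inj₂ (_ , refl)) = inj₂ (e-wv e)

  gadgetEnd-surjective : ∀ v h → HAdj G (orig v) h →
    Σ (Fin n) λ d → Σ (Adj G v d) λ vd → gadgetEnd vd ≡ h
  gadgetEnd-surjective _ _ (inj₁ (e-ux e)) = tgt G e , (e , inj₁ (refl , refl)) , refl
  gadgetEnd-surjective _ _ (inj₂ (e-wv e)) = src G e , (e , inj₂ (refl , refl)) , refl

  gadgetEnd-injective : ∀ {v d d'} (vd : Adj G v d) (vd' : Adj G v d') →
    gadgetEnd vd ≡ gadgetEnd vd' → d ≡ d'
  gadgetEnd-injective (_ , inj₁ (_ , refl)) (_ , inj₁ (_ , refl)) refl = refl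
  gadgetEnd-injective (_ , inj₂ (refl , _)) (_ , inj₂ (refl , _)) refl = refl

  gadgetEnd-irrelevant : ∀ {v d} (vd vd' : Adj G v d) → gadgetEnd vd ≡ gadgetEnd vd'
  gadgetEnd-irrelevant (e , inj₁ (refl , refl)) (e' , inj₁ (p , q)) =
    cong (λ e → gad e gx) (noMulti G e e' (inj₁ (sym (cong₂ _,_ p q))))
  gadgetEnd-irrelevant (e , inj₂ (refl , refl)) (e' , inj₂ (p , q)) =
    cong (λ e → gad e gw) (noMulti G e e' (inj₁ (sym (cong₂ _,_ p q))))
  gadgetEnd-irrelevant (e , inj₁ (refl , refl)) (e' , inj₂ (p , q))
    with noMulti G e e' (inj₂ (sym q , sym p))
  ... | refl = ⊥-elim (loopless G e p)
  gadgetEnd-irrelevant (e , inj₂ (refl , refl)) (e' , inj₁ (p , q))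
    with noMulti G e e' (inj₂ (sym q , sym p))
  ... | refl = ⊥-elim (loopless G e (sym q))

  orig-degree3 : ∀ {v} → Degree3 (Adj G) v → Degree3 (HAdj G) (orig v)
  orig-degree3 {v} (_ , _ , _ , a≢b , a≢c , b≢c , va , vb , vc , complete) =
    gadgetEnd va , gadgetEnd vb , gadgetEnd vc ,
    a≢b ∘ gadgetEnd-injective va vb , a≢c ∘ gadgetEnd-injective va vc ,
    b≢c ∘ gadgetEnd-injective vb vc ,
    gadgetEnd-adjacent va , gadgetEnd-adjacent vb , gadgetEnd-adjacent vc , completeH
    where
    completeH : ∀ h → HAdj G (orig v) h →
      h ≡ gadgetEnd va ⊎ h ≡ gadgetEnd vb ⊎ h ≡ gadgetEnd vc
    completeH h vh with gadgetEnd-surjective v h vh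
    ... | d , vd , refl with complete d vd
    ... | inj₁ refl        = inj₁ (gadgetEnd-irrelevant vd va)
    ... | inj₂ (inj₁ refl) = inj₂ (inj₁ (gadgetEnd-irrelevant vd vb))
    ... | inj₂ (inj₂ refl) = inj₂ (inj₂ (gadgetEnd-irrelevant vd vc))

  module _ (co : ColouredOrientation (HAdj G) IsOutvertex) (good : Good co) where
    open ColouredOrientation co using (col)

    good⇒exactlyOneOpposite : ∀ {v} ((a , b , c , _) : Degree3 (HAdj G) v) →
      ExactlyOneOpposite (col v) (col a) (col b) (col c)
    good⇒exactlyOneOpposite {v} D@(a , b , c , N) =
      uniqueOpposite⇒exactlyOne (HAdj G) col N (proj₁ (good v D))

    gadget-ends-opposite-at : ∀ e →
      col (gad e gx) ≢ col (orig (tgt G e)) × col (gad e gw) ≢ col (orig (src G e))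
    gadget-ends-opposite-at e = gadget-ends-opposite _ _ _ _ _ _ _ _
      (good⇒exactlyOneOpposite (_ , _ , _ , x-neighbours e))
      (good⇒exactlyOneOpposite (_ , _ , _ , y-neighbours e))
      (good⇒exactlyOneOpposite (_ , _ , _ , z-neighbours e))
      (good⇒exactlyOneOpposite (_ , _ , _ , w-neighbours e))

    gadgetEnd-opposite-far : ∀ {v d} (vd : Adj G v d) → col (gadgetEnd vd) ≢ col (orig d)
    gadgetEnd-opposite-far (e , inj₁ (_ , refl)) = proj₁ (gadget-ends-opposite-at e)
    gadgetEnd-opposite-far (e , inj₂ (refl , _)) = proj₂ (gadget-ends-opposite-at e)

    sameColourNeighbour : ∀ v → UniqueOpposite (HAdj G) col (orig v) →
      Σ (Fin n) λ a → Adj G v a × col (orig a) ≡ col (orig v) ×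
        (∀ b → Adj G v b → col (orig b) ≡ col (orig v) → b ≡ a)
    sameColourNeighbour v (h , vh , h≢v , unique) with gadgetEnd-surjective v h vh
    ... | d , vd , refl =
      d , vd , ≢-≢⇒≡ (gadgetEnd-opposite-far vd ∘ sym) (h≢v ∘ sym) , λ b vb b≡v →
        gadgetEnd-injective vb vd (unique (gadgetEnd vb) (gadgetEnd-adjacent vb)
          (subst (col (gadgetEnd vb) ≢_) b≡v (gadgetEnd-opposite-far vb)))

    twoColouredPM : Cubic G → TwoColouredPM G
    twoColouredPM cubic = col ∘ orig , λ v →
      sameColourNeighbour v (proj₁ (good (orig v) (orig-degree3 (cubic v))))

lemma12 : ∀ {n m} (G : SimpleGraph n m) → Cubic G → Planar G →
    Σ (ColouredOrientation (HAdj G) IsOutvertex) Good →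
    TwoColouredPM G
lemma12 G cubic _ (co , good) = twoColouredPM G co good cubic
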